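{- Let $G$ be a finite group and $L,R\le G$ subgroups such that $L\cap R$ is core-free in $G$, and let $\Gamma=\mathrm{Cos}(G,L,R)$. Then the following are equivalent: (i) $\Gamma$ is the incidence graph of a $G$-flag-transitive $2$-design with point set $[G:L]$ and block set $[G:R]$; (ii) $|\Gamma(\alpha_1)\cap\Gamma(\alpha_2)|$ is the same constant for all distinct $\alpha_1,\alpha_2\in[G:L]$; (iii) $\frac{|RL\cap RLg|}{|R|}$ is the same constant for all $g\in G\setminus L$. Consequently, if $\mathcal{D}$ is a $G$-flag-transitive $2$-design with parameter $\lambda$, then for any flag $(\alpha,\beta)$ and any $g\in G\setminus G_\alpha$ one has $\frac{|G_\beta G_\alpha\cap G_\beta G_\alpha g|}{|G_\beta|}=\lambda$.
   Context: $[G:L]$ is the set of right cosets of $L$ in $G$. $\mathrm{Cos}(G,L,R)$ is the bipartite graph with parts $[G:L]$ and $[G:R]$, where $Lx\sim Ry$ iff $Lx\cap Ry\ne\emptyset$; $G$ acts by right multiplication. $\Gamma(u)$ is the neighbourhood of a vertex $u$. A $2$-design $(\mathcal{P},\mathcal{B},\mathcal{I})$ has every block incident with $k$ points and any two distinct points incident with exactly $\lambda$ common blocks; a flag is an incident point-block pair; it is $G$-flag-transitive if $G\le\mathrm{Aut}$ is transitive on flags. Its incidence graph is the bipartite graph with parts $\mathcal{P}$ and $\mathcal{B}$ and edge set the set of flags. $G_\alpha,G_\beta$ are stabilizers. -}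

module Defs where

open import Data.Nat using (ℕ; _*_)
open import Data.Fin using (Fin)
open import Data.Fin.Subset using (Subset; _∈_; _∉_; ∣_∣)
open import Data.List using (List; length)
open import Data.List.Relation.Unary.Unique.Propositional using (Unique)
open import Data.List.Membership.Propositional using () renaming (_∈_ to _∈ₗ_)
open import Data.Product using (Σ; ∃; ∃-syntax; _×_; _,_)
open import Data.Unit using (⊤)
open import Function.Bundles using (_⇔_)
open import Relation.Binary.PropositionalEquality using (_≡_; _≢_)
open import Relation.Nullary using (¬_)

HasCard : {A : Set} → (A → Set) → ℕ → Set
HasCard {A} P k =
  Σ (List A) λ xs → Unique xs × (∀ a → (a ∈ₗ xs) ⇔ P a) × length xs ≡ k

-- A finite group: carrier Fin n (every finite group is isomorphic to one
-- of this form), with multiplication, identity and inverse.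

record FinGroup (n : ℕ) : Set where
  infixl 7 _·_
  field
    _·_   : Fin n → Fin n → Fin n
    e     : Fin n
    _⁻¹   : Fin n → Fin n
    assoc : ∀ x y z → (x · y) · z ≡ x · (y · z)
    idˡ   : ∀ x → e · x ≡ x
    idʳ   : ∀ x → x · e ≡ x
    invˡ  : ∀ x → (x ⁻¹) · x ≡ e
    invʳ  : ∀ x → x · (x ⁻¹) ≡ e

module _ {n : ℕ} (G : FinGroup n) where
  open FinGroup G

  IsSubgroup : Subset n → Set
  IsSubgroup H = (e ∈ H) × (∀ x y → x ∈ H → y ∈ H → (x · y) ∈ H)
                 × (∀ x → x ∈ H → (x ⁻¹) ∈ H)

  _∈∩_ : Fin n → Subset n × Subset n → Set
  x ∈∩ (H , K) = (x ∈ H) × (x ∈ K)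

  CoreFree : (Fin n → Set) → Set
  CoreFree H = ∀ x → (∀ g → H ((g ⁻¹) · x · g)) → x ≡ e

  IsRightCoset : Subset n → Subset n → Set
  IsRightCoset H C = ∃[ x ] (∀ z → (z ∈ C) ⇔ (∃[ h ] (h ∈ H × z ≡ h · x)))

  Meets : Subset n → Subset n → Set
  Meets A B = ∃[ z ] (z ∈ A × z ∈ B)

  Translate : Subset n → Fin n → Subset n → Set
  Translate C g D = ∀ z → (z ∈ D) ⇔ (∃[ w ] (w ∈ C × z ≡ w · g))

  InRL : Subset n → Subset n → Fin n → Set
  InRL R L x = ∃[ r ] ∃[ l ] (r ∈ R × l ∈ L × x ≡ r · l)

  InRLg : Subset n → Subset n → Fin n → Fin n → Set
  InRLg R L g x = ∃[ r ] ∃[ l ] (r ∈ R × l ∈ L × x ≡ (r · l) · g)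

  -- Γ = Cos(G,L,R): points [G:L], blocks [G:R], P ~ B iff P ∩ B ≠ ∅.
  -- (i) Γ is the incidence graph of a G-flag-transitive 2-design with
  --     point set [G:L] and block set [G:R] (G acting by right multiplication).
  CosDesign : Subset n → Subset n → Set
  CosDesign L R = ∃[ k ] ∃[ λ' ]
      ((∀ B → IsRightCoset R B →
          HasCard (λ P → IsRightCoset L P × Meets P B) k)
    × (∀ P₁ P₂ → IsRightCoset L P₁ → IsRightCoset L P₂ → P₁ ≢ P₂ →
          HasCard (λ B → IsRightCoset R B × Meets P₁ B × Meets P₂ B) λ')
      -- G ≤ Aut: the action on points and blocks is faithful
    × (∀ g → (∀ P → IsRightCoset L P → Translate P g P)
           → (∀ B → IsRightCoset R B → Translate B g B) → g ≡ e)
    × (∀ P B P' B' → IsRightCoset L P → IsRightCoset R B → Meets P B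
         → IsRightCoset L P' → IsRightCoset R B' → Meets P' B'
         → ∃[ g ] (Translate P g P' × Translate B g B')))

  ConstCommonNbrs : Subset n → Subset n → Set
  ConstCommonNbrs L R = ∃[ c ]
    (∀ P₁ P₂ → IsRightCoset L P₁ → IsRightCoset L P₂ → P₁ ≢ P₂ →
       HasCard (λ B → IsRightCoset R B × Meets P₁ B × Meets P₂ B) c)

  ConstRatio : Subset n → Subset n → Set
  ConstRatio L R = ∃[ c ]
    (∀ g → g ∉ L → HasCard (λ x → InRL R L x × InRLg R L g x) (c * ∣ R ∣))

  record FlagTransitive2Design : Set₁ where
    field
      Pt Blk : Set
      I      : Pt → Blk → Set
      v b k λ' : ℕ
      finPt  : HasCard (λ (_ : Pt) → ⊤) v
      finBlk : HasCard (λ (_ : Blk) → ⊤) b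
      blockSize : ∀ B → HasCard (λ p → I p B) k
      pairCount : ∀ p q → p ≢ q → HasCard (λ B → I p B × I q B) λ'
      actP : Pt → Fin n → Pt
      actB : Blk → Fin n → Blk
      actP-e : ∀ p → actP p e ≡ p
      actB-e : ∀ B → actB B e ≡ B
      actP-· : ∀ p g h → actP (actP p g) h ≡ actP p (g · h)
      actB-· : ∀ B g h → actB (actB B g) h ≡ actB B (g · h)
      actI   : ∀ p B g → I p B ⇔ I (actP p g) (actB B g)
      -- G ≤ Aut(D): faithful
      faithful : ∀ g → (∀ p → actP p g ≡ p) → (∀ B → actB B g ≡ B) → g ≡ e
      flagTrans : ∀ p B p' B' → I p B → I p' B' →
                  ∃[ g ] (actP p g ≡ p' × actB B g ≡ B')

-- Everything is orbit counting for right actions of G.  The block Rz meets the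
-- point Lx iff zx⁻¹ ∈ RL, and the stabiliser of the block R is R itself, so the
-- common blocks of Lx and Ly, each counted |R| times, are the z ∈ RLx ∩ RLy;
-- translating by x⁻¹ turns these into RL ∩ RL(yx⁻¹), and yx⁻¹ ∉ L exactly when
-- Lx ≠ Ly.  This gives (ii) ⇔ (iii).  For (ii) ⇒ (i), transitivity of G on the
-- cosets makes all blocks equally large and G flag-transitive, and G acts
-- faithfully because an element fixing every coset of L and of R lies in the
-- core of L ∩ R.  In an abstract flag-transitive design the same count runs
-- over the orbit of β: flag-transitivity gives α I βx iff x ∈ G_β G_α, and
-- hence αg I βx iff x ∈ G_β G_α g.
{-# OPTIONS --safe #-}
module Submission where

open import Defs
open import Level using (0ℓ)
open import Algebra.Bundles using (Group)
import Algebra.Properties.Group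
open import Data.Nat using (ℕ; _+_; _*_; NonZero)
open import Data.Nat.Properties using (*-cancelʳ-≡)
open import Data.Fin using (Fin; zero; suc)
open import Data.Fin.Properties using (suc-injective; any?)
open import Data.Fin.Subset using (Subset; inside; outside; _∈_; ∣_∣)
open import Data.Vec using ([]; _∷_; here; there; tabulate; lookup)
open import Data.Vec.Properties
  using (lookup∘tabulate; tabulate∘lookup; tabulate-cong; []=⇒lookup; lookup⇒[]=; ≡-dec)
open import Data.Fin.Subset.Properties using (⊆-antisym; _∈?_)
import Data.Bool.Properties as Bool
open import Data.List using (List; []; _∷_; length; map; _++_; filter; deduplicate; allFin)
open import Data.List.Properties using (length-map; length-++)
open import Data.List.Relation.Unary.All as All using (All; []; _∷_)
open import Data.List.Relation.Unary.Any using (here; there; index)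
open import Data.List.Relation.Unary.Any.Properties using (lookup-index)
open import Data.List.Relation.Unary.AllPairs using ([]; _∷_)
open import Data.List.Relation.Unary.Unique.Propositional using (Unique)
open import Data.List.Relation.Unary.Unique.Propositional.Properties as Unique using ()
open import Data.List.Relation.Unary.Unique.DecPropositional.Properties using (deduplicate-!)
open import Data.List.Membership.Propositional using () renaming (_∈_ to _∈ₗ_)
open import Data.List.Membership.Propositional.Properties
  using (∈-map⁺; ∈-map⁻; ++-∈⇔; ∈-filter⁺; ∈-filter⁻; ∈-deduplicate⁺; ∈-allFin)
open import Data.List.Membership.Propositional.Properties.WithK
  using (unique⇒irrelevant; unique∧set⇒bag)
open import Data.List.Relation.Binary.BagAndSetEquality using (∼bag⇒↭)
open import Data.List.Relation.Binary.Permutation.Propositional.Properties using (↭-length)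
open import Data.Product using (∃; ∃-syntax; _×_; _,_; proj₁; proj₂)
open import Data.Sum using (_⊎_; inj₁; inj₂; [_,_])
open import Data.Sum.Function.Propositional using (_⊎-⇔_)
open import Data.Product.Function.NonDependent.Propositional using (_×-⇔_)
open import Data.Unit using (⊤; tt)
open import Data.Empty using (⊥)
open import Function using (_∘_)
open import Function.Bundles using (_⇔_; mk⇔; Equivalence)
open import Function.Definitions using (Injective)
import Function.Properties.Equivalence as ⇔
open import Relation.Binary.Definitions using (DecidableEquality)
open import Relation.Binary.PropositionalEquality
  using (_≡_; _≢_; refl; sym; trans; cong; cong₂; subst; subst₂; isEquivalence; module ≡-Reasoning)
open import Relation.Nullary using (¬_; Dec)
open import Relation.Nullary.Decidable using (map′; _×-dec_)
open import Relation.Unary using (Decidable; _∪_; _⊢_; ｛_｝)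

open Equivalence using (to; from)

private variable
  A B : Set
  P Q T : A → Set
  a : A
  c i j k m : ℕ

HasCard-unique : HasCard P i → HasCard P j → i ≡ j
HasCard-unique (xs , xs! , ∈xs , refl) (ys , ys! , ∈ys , refl) =
  ↭-length (∼bag⇒↭ (unique∧set⇒bag xs! ys! λ {a} → ⇔.trans (∈xs a) (⇔.sym (∈ys a))))

HasCard-cong : (∀ a → P a ⇔ Q a) → HasCard P k → HasCard Q k
HasCard-cong P⇔Q (xs , xs! , ∈xs , ∣xs∣) = xs , xs! , (λ a → ⇔.trans (∈xs a) (P⇔Q a)) , ∣xs∣

HasCard⇒NonZero : P a → HasCard P k → NonZero k
HasCard⇒NonZero {a = a} Pa ([] , _ , ∈xs , refl) with () ← from (∈xs a) Pa
HasCard⇒NonZero Pa (_ ∷ _ , _ , _ , refl) = _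

HasCard-｛｝ : (a : A) → HasCard ｛ a ｝ 1
HasCard-｛｝ a =
  a ∷ [] , [] ∷ [] , (λ b → mk⇔ (λ { (here eq) → sym eq }) (λ { refl → here refl })) , refl

HasCard-∪ : (∀ a → P a → Q a → ⊥) → HasCard P i → HasCard Q j → HasCard (P ∪ Q) (i + j)
HasCard-∪ P∩Q=∅ (xs , xs! , ∈xs , refl) (ys , ys! , ∈ys , refl) =
  xs ++ ys ,
  Unique.++⁺ xs! ys! (λ (a∈xs , a∈ys) → P∩Q=∅ _ (to (∈xs _) a∈xs) (to (∈ys _) a∈ys)) ,
  (λ a → ⇔.trans ++-∈⇔ (∈xs a ⊎-⇔ ∈ys a)) ,
  length-++ xs

HasCard-image : (f : A → B) → Injective _≡_ _≡_ f → HasCard P k →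
                HasCard (λ b → ∃[ a ] (P a × b ≡ f a)) k
HasCard-image {P = P} f f-injective (xs , xs! , ∈xs , ∣xs∣) =
  map f xs , Unique.map⁺ f-injective xs! , (λ b → mk⇔ forth back) , trans (length-map f xs) ∣xs∣
  where
  forth : ∀ {b} → b ∈ₗ map f xs → ∃[ a ] (P a × b ≡ f a)
  forth b∈ with a , a∈xs , refl ← ∈-map⁻ f b∈ = a , to (∈xs a) a∈xs , refl
  back : ∀ {b} → ∃[ a ] (P a × b ≡ f a) → b ∈ₗ map f xs
  back (a , Pa , refl) = ∈-map⁺ f (from (∈xs a) Pa)

module _ (f : A → B) (fibre : ∀ b → T b → HasCard (λ a → f a ≡ b) m) where

  HasCard-∈-preimage : (bs : List B) → Unique bs → All T bs →
                       HasCard (λ a → f a ∈ₗ bs) (length bs * m)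
  HasCard-∈-preimage [] [] [] = [] , [] , (λ _ → mk⇔ (λ ()) (λ ())) , refl
  HasCard-∈-preimage (b ∷ bs) (b∉bs ∷ bs!) (Tb ∷ Tbs) =
    HasCard-cong (λ a → mk⇔ [ here , there ] ∷-case)
      (HasCard-∪ (λ a fa≡b fa∈bs → All.lookup b∉bs fa∈bs (sym fa≡b))
                 (fibre b Tb) (HasCard-∈-preimage bs bs! Tbs))
    where
    ∷-case : ∀ {a} → f a ∈ₗ b ∷ bs → f a ≡ b ⊎ f a ∈ₗ bs
    ∷-case (here fa≡b) = inj₁ fa≡b
    ∷-case (there fa∈bs) = inj₂ fa∈bs

  HasCard-preimage : HasCard T c → HasCard (f ⊢ T) (c * m)
  HasCard-preimage (bs , bs! , ∈bs , refl) =
    HasCard-cong (λ a → ∈bs (f a)) (HasCard-∈-preimage bs bs! (All.tabulate (to (∈bs _))))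

dec⇒∃HasCard : DecidableEquality A → Decidable P → (xs : List A) → (∀ a → P a → a ∈ₗ xs) →
               ∃ (HasCard P)
dec⇒∃HasCard _≟_ P? xs P⊆xs =
  _ , filter P? (deduplicate _≟_ xs) , Unique.filter⁺ P? (deduplicate-! _≟_ xs) ,
  (λ a → mk⇔ (proj₂ ∘ ∈-filter⁻ P? {xs = deduplicate _≟_ xs})
              (λ Pa → ∈-filter⁺ P? (∈-deduplicate⁺ _≟_ (P⊆xs a Pa)) Pa)) ,
  refl

HasCard⇒≡-dec : HasCard (λ (_ : A) → ⊤) k → DecidableEquality A
HasCard⇒≡-dec (xs , xs! , ∈xs , _) a b =
  map′ (λ eq → trans (lookup-index a∈xs) (trans (cong (Data.List.lookup xs) eq)
                                                  (sym (lookup-index b∈xs))))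
       (λ { refl → cong index (unique⇒irrelevant xs! a∈xs b∈xs) })
       (index a∈xs Data.Fin.≟ index b∈xs)
  where
  a∈xs : a ∈ₗ xs
  a∈xs = from (∈xs a) tt
  b∈xs : b ∈ₗ xs
  b∈xs = from (∈xs b) tt

HasCard-∈ : ∀ {n} (p : Subset n) → HasCard (_∈ p) ∣ p ∣
HasCard-∈ [] = [] , [] , (λ ()) , refl
HasCard-∈ (outside ∷ p) = HasCard-cong ∈-outside (HasCard-image suc suc-injective (HasCard-∈ p))
  where
  ∈-outside : ∀ x → (∃[ y ] (y ∈ p × x ≡ suc y)) ⇔ x ∈ outside ∷ p
  ∈-outside x = mk⇔ (λ { (y , y∈p , refl) → there y∈p }) (λ { (there y∈p) → _ , y∈p , refl })
HasCard-∈ (inside ∷ p) =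
  HasCard-cong ∈-inside
    (HasCard-∪ (λ { _ refl (_ , _ , ()) })
               (HasCard-｛｝ zero) (HasCard-image suc suc-injective (HasCard-∈ p)))
  where
  ∈-inside : ∀ x → (zero ≡ x ⊎ (∃[ y ] (y ∈ p × x ≡ suc y))) ⇔ x ∈ inside ∷ p
  ∈-inside x = mk⇔ (λ { (inj₁ refl) → here ; (inj₂ (y , y∈p , refl)) → there y∈p })
                   (λ { here → inj₁ refl ; (there y∈p) → inj₂ (_ , y∈p , refl) })

module FinGroupProperties {n} (G : FinGroup n) where
  open FinGroup G

  group : Group 0ℓ 0ℓ
  group = record
    { isGroup = record
      { isMonoid = record
        { isSemigroup = record
          { isMagma = record { isEquivalence = isEquivalence ; ∙-cong = cong₂ _·_ }
          ; assoc = assoc }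
        ; identity = idˡ , idʳ }
      ; inverse = invˡ , invʳ
      ; ⁻¹-cong = cong _⁻¹ } }

  open Algebra.Properties.Group group public

  x·e⁻¹≡x : ∀ x → x · e ⁻¹ ≡ x
  x·e⁻¹≡x x = trans (cong (x ·_) ε⁻¹≈ε) (idʳ x)

  ·⁻¹-≡⇔ : ∀ {x g y} → x · g ⁻¹ ≡ y ⇔ x ≡ y · g
  ·⁻¹-≡⇔ {x} {g} {y} = mk⇔
    (λ eq → trans (sym (//-rightDividesˡ g x)) (cong (_· g) eq))
    (λ eq → sym (x≈z//y y g x (sym eq)))

module RightAction {n} (G : FinGroup n) {X : Set} (act : X → Fin n → X)
  (act-identity : ∀ x → act x (FinGroup.e G) ≡ x)
  (act-assoc : ∀ x g h → act (act x g) h ≡ act x (FinGroup._·_ G g h)) where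
  open FinGroup G
  open FinGroupProperties G
  open ≡-Reasoning

  infixl 6 _◃_
  _◃_ : X → Fin n → X
  _◃_ = act

  ◃-inverseʳ : ∀ x g → (x ◃ g) ◃ g ⁻¹ ≡ x
  ◃-inverseʳ x g = begin
    (x ◃ g) ◃ g ⁻¹  ≡⟨ act-assoc x g (g ⁻¹) ⟩
    x ◃ (g · g ⁻¹)  ≡⟨ cong (x ◃_) (invʳ g) ⟩
    x ◃ e           ≡⟨ act-identity x ⟩
    x               ∎

  ◃-inverseˡ : ∀ x g → (x ◃ g ⁻¹) ◃ g ≡ x
  ◃-inverseˡ x g = begin
    (x ◃ g ⁻¹) ◃ g  ≡⟨ act-assoc x (g ⁻¹) g ⟩
    x ◃ (g ⁻¹ · g)  ≡⟨ cong (x ◃_) (invˡ g) ⟩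
    x ◃ e           ≡⟨ act-identity x ⟩
    x               ∎

  HasCard-◃ : ∀ g → HasCard P k → HasCard (λ y → P (y ◃ g)) k
  HasCard-◃ {P = P} g P-card =
    HasCard-cong image⇔ (HasCard-image (_◃ g ⁻¹) ◃g⁻¹-injective P-card)
    where
    ◃g⁻¹-injective : ∀ {x y} → x ◃ g ⁻¹ ≡ y ◃ g ⁻¹ → x ≡ y
    ◃g⁻¹-injective {x} {y} eq =
      trans (sym (◃-inverseˡ x g)) (trans (cong (_◃ g) eq) (◃-inverseˡ y g))
    image⇔ : ∀ y → (∃[ x ] (P x × y ≡ x ◃ g ⁻¹)) ⇔ P (y ◃ g)
    image⇔ y = mk⇔ (λ { (x , Px , refl) → subst P (sym (◃-inverseˡ x g)) Px })
                   (λ Pyg → y ◃ g , Pyg , sym (◃-inverseʳ y g))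

  ◃-≡⇔ : ∀ x g h → x ◃ g ≡ x ◃ h ⇔ x ◃ (g · h ⁻¹) ≡ x
  ◃-≡⇔ x g h = mk⇔
    (λ xg≡xh → begin
      x ◃ (g · h ⁻¹)   ≡⟨ act-assoc x g (h ⁻¹) ⟨
      (x ◃ g) ◃ h ⁻¹   ≡⟨ cong (_◃ h ⁻¹) xg≡xh ⟩
      (x ◃ h) ◃ h ⁻¹   ≡⟨ ◃-inverseʳ x h ⟩
      x                ∎)
    (λ x[gh⁻¹]≡x → begin
      x ◃ g                  ≡⟨ cong (x ◃_) (//-rightDividesˡ h g) ⟨
      x ◃ ((g · h ⁻¹) · h)   ≡⟨ act-assoc x (g · h ⁻¹) h ⟨
      (x ◃ (g · h ⁻¹)) ◃ h   ≡⟨ cong (_◃ h) x[gh⁻¹]≡x ⟩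
      x ◃ h                  ∎)

  HasCard-fibre : ∀ x g → HasCard (λ h → x ◃ h ≡ x) m → HasCard (λ h → x ◃ h ≡ x ◃ g) m
  HasCard-fibre x g stabiliser-card =
    HasCard-cong coset⇔ (HasCard-image (_· g) (∙-cancelʳ g _ _) stabiliser-card)
    where
    coset⇔ : ∀ h → (∃[ s ] (x ◃ s ≡ x × h ≡ s · g)) ⇔ x ◃ h ≡ x ◃ g
    coset⇔ h = mk⇔
      (λ { (s , xs≡x , refl) → trans (sym (act-assoc x s g)) (cong (_◃ g) xs≡x) })
      (λ xh≡xg → h · g ⁻¹ , to (◃-≡⇔ x h g) xh≡xg , sym (//-rightDividesˡ g h))

  HasCard-orbit : ∀ x → HasCard (λ h → x ◃ h ≡ x) m → (∀ y → T y → ∃[ g ] x ◃ g ≡ y) →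
                  HasCard T c → HasCard (λ h → T (x ◃ h)) (c * m)
  HasCard-orbit {m = m} {T = T} x stabiliser-card orbit = HasCard-preimage (x ◃_) fibre
    where
    fibre : ∀ y → T y → HasCard (λ h → x ◃ h ≡ y) m
    fibre y Ty with g , refl ← orbit y Ty = HasCard-fibre x g stabiliser-card

module Cosets {n} (G : FinGroup n) where
  open FinGroup G
  open FinGroupProperties G
  open ≡-Reasoning

  infixl 6 _·ˢ_
  _·ˢ_ : Subset n → Fin n → Subset n
  C ·ˢ g = tabulate λ z → lookup C (z · g ⁻¹)

  ∈-·ˢ : ∀ {C g z} → z ∈ C ·ˢ g ⇔ z · g ⁻¹ ∈ C
  ∈-·ˢ {C} {g} {z} = mk⇔
    (λ z∈Cg → lookup⇒[]= _ C (trans (sym (lookup∘tabulate _ z)) ([]=⇒lookup z∈Cg)))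
    (λ zg⁻¹∈C → lookup⇒[]= z _ (trans (lookup∘tabulate _ z) ([]=⇒lookup zg⁻¹∈C)))

  ·ˢ-identity : ∀ C → C ·ˢ e ≡ C
  ·ˢ-identity C = trans (tabulate-cong λ z → cong (lookup C) (x·e⁻¹≡x z)) (tabulate∘lookup C)

  ·ˢ-assoc : ∀ C g h → (C ·ˢ g) ·ˢ h ≡ C ·ˢ (g · h)
  ·ˢ-assoc C g h = tabulate-cong λ z → begin
    lookup (C ·ˢ g) (z · h ⁻¹)     ≡⟨ lookup∘tabulate _ (z · h ⁻¹) ⟩
    lookup C (z · h ⁻¹ · g ⁻¹)     ≡⟨ cong (lookup C) (assoc z (h ⁻¹) (g ⁻¹)) ⟩
    lookup C (z · (h ⁻¹ · g ⁻¹))   ≡⟨ cong (λ t → lookup C (z · t)) (⁻¹-anti-homo-∙ g h) ⟨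
    lookup C (z · (g · h) ⁻¹)      ∎

  module Translation = RightAction G _·ˢ_ ·ˢ-identity ·ˢ-assoc
  module Regular = RightAction G _·_ idʳ assoc

  translate-·ˢ : ∀ C g → Translate G C g (C ·ˢ g)
  translate-·ˢ C g z = mk⇔
    (λ z∈Cg → z · g ⁻¹ , to ∈-·ˢ z∈Cg , sym (//-rightDividesˡ g z))
    (λ { (w , w∈C , refl) → from ∈-·ˢ (subst (_∈ C) (sym (//-rightDividesʳ g w)) w∈C) })

  Translate⇒≡ : ∀ {C g D} → Translate G C g D → C ·ˢ g ≡ D
  Translate⇒≡ {C} {g} CgD = ⊆-antisym
    (λ z∈Cg → from (CgD _) (to (translate-·ˢ C g _) z∈Cg))
    (λ z∈D → from (translate-·ˢ C g _) (to (CgD _) z∈D))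

  IsRightCoset⇔ : ∀ {H C} → IsRightCoset G H C ⇔ (∃[ x ] H ·ˢ x ≡ C)
  IsRightCoset⇔ {H} = mk⇔ (λ (x , HxC) → x , Translate⇒≡ HxC)
                          (λ { (x , refl) → x , translate-·ˢ H x })

  IsRightCoset-·ˢ : ∀ {H C} g → IsRightCoset G H C → IsRightCoset G H (C ·ˢ g)
  IsRightCoset-·ˢ {H} g C-coset with x , refl ← to IsRightCoset⇔ C-coset =
    from IsRightCoset⇔ (x · g , sym (·ˢ-assoc H x g))

  Meets-·ˢ : ∀ {C D} g → Meets G C D → Meets G (C ·ˢ g) (D ·ˢ g)
  Meets-·ˢ {C} {D} g (z , z∈C , z∈D) =
    z · g , from (translate-·ˢ C g _) (z , z∈C , refl) , from (translate-·ˢ D g _) (z , z∈D , refl)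

  IsRightCoset? : ∀ H → Decidable (IsRightCoset G H)
  IsRightCoset? H C =
    map′ (from IsRightCoset⇔) (to IsRightCoset⇔) (any? λ x → ≡-dec Bool._≟_ (H ·ˢ x) C)

  Meets? : ∀ C D → Dec (Meets G C D)
  Meets? C D = any? λ z → (z ∈? C) ×-dec (z ∈? D)

  ∃HasCard-cosets : ∀ {H} {P : Subset n → Set} → Decidable P → (∀ C → P C → IsRightCoset G H C) →
                    ∃ (HasCard P)
  ∃HasCard-cosets {H} P? P⇒coset =
    dec⇒∃HasCard (≡-dec Bool._≟_) P? (map (H ·ˢ_) (allFin n)) λ C PC →
      let x , Hx≡C = to IsRightCoset⇔ (P⇒coset C PC)
      in subst (_∈ₗ _) Hx≡C (∈-map⁺ (H ·ˢ_) (∈-allFin x))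

  HasCard-incidentCosets-·ˢ : ∀ {H B} g → HasCard (λ P → IsRightCoset G H P × Meets G P B) k →
                              HasCard (λ P → IsRightCoset G H P × Meets G P (B ·ˢ g)) k
  HasCard-incidentCosets-·ˢ {H = H} {B} g incident-card =
    HasCard-cong (λ P → coset⇔ ×-⇔ meets⇔) (Translation.HasCard-◃ (g ⁻¹) incident-card)
    where
    coset⇔ : ∀ {P} → IsRightCoset G H (P ·ˢ g ⁻¹) ⇔ IsRightCoset G H P
    coset⇔ {P} = mk⇔ (subst (IsRightCoset G H) (Translation.◃-inverseˡ P g) ∘ IsRightCoset-·ˢ g)
                     (IsRightCoset-·ˢ (g ⁻¹))
    meets⇔ : ∀ {P} → Meets G (P ·ˢ g ⁻¹) B ⇔ Meets G P (B ·ˢ g)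
    meets⇔ {P} = mk⇔ (subst (λ Q → Meets G Q (B ·ˢ g)) (Translation.◃-inverseˡ P g) ∘ Meets-·ˢ g)
                     (subst (Meets G (P ·ˢ g ⁻¹)) (Translation.◃-inverseʳ B g) ∘ Meets-·ˢ (g ⁻¹))

  module Subgroup {H} (H≤G : IsSubgroup G H) where
    e∈H : e ∈ H
    e∈H = proj₁ H≤G

    ·-closed : ∀ {x y} → x ∈ H → y ∈ H → x · y ∈ H
    ·-closed = proj₁ (proj₂ H≤G) _ _

    ⁻¹-closed : ∀ {x} → x ∈ H → x ⁻¹ ∈ H
    ⁻¹-closed = proj₂ (proj₂ H≤G) _

    ∈-·ˢ-self : ∀ x → x ∈ H ·ˢ x
    ∈-·ˢ-self x = from ∈-·ˢ (subst (_∈ H) (sym (invʳ x)) e∈H)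

    ·ˢ-stabiliser : ∀ {g} → H ·ˢ g ≡ H ⇔ g ∈ H
    ·ˢ-stabiliser {g} = mk⇔
      (λ Hg≡H → subst (g ∈_) Hg≡H (∈-·ˢ-self g))
      (λ g∈H → ⊆-antisym
        (λ z∈Hg → subst (_∈ H) (//-rightDividesˡ g _) (·-closed (to ∈-·ˢ z∈Hg) g∈H))
        (λ z∈H → from ∈-·ˢ (·-closed z∈H (⁻¹-closed g∈H))))

    ·ˢ-≡⇔ : ∀ {x y} → H ·ˢ x ≡ H ·ˢ y ⇔ x · y ⁻¹ ∈ H
    ·ˢ-≡⇔ {x} {y} = ⇔.trans (Translation.◃-≡⇔ H x y) ·ˢ-stabiliser

    HasCard-stabiliser : HasCard (λ g → H ·ˢ g ≡ H) ∣ H ∣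
    HasCard-stabiliser = HasCard-cong (λ _ → ⇔.sym ·ˢ-stabiliser) (HasCard-∈ H)

    ·ˢ-∈ : ∀ {C z} → IsRightCoset G H C → z ∈ C → H ·ˢ z ≡ C
    ·ˢ-∈ C-coset z∈C with x , refl ← to IsRightCoset⇔ C-coset = from ·ˢ-≡⇔ (to ∈-·ˢ z∈C)

    Translate-cosets : ∀ {C C' z z'} → IsRightCoset G H C → IsRightCoset G H C' → z ∈ C → z' ∈ C' →
                       Translate G C (z ⁻¹ · z') C'
    Translate-cosets {z = z} {z'} C-coset C'-coset z∈C z'∈C' =
      subst₂ (λ C C' → Translate G C (z ⁻¹ · z') C') (·ˢ-∈ C-coset z∈C) (·ˢ-∈ C'-coset z'∈C')
        (subst (Translate G (H ·ˢ z) (z ⁻¹ · z')) Hz[z⁻¹z']≡Hz' (translate-·ˢ (H ·ˢ z) (z ⁻¹ · z')))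
      where
      Hz[z⁻¹z']≡Hz' : H ·ˢ z ·ˢ (z ⁻¹ · z') ≡ H ·ˢ z'
      Hz[z⁻¹z']≡Hz' = trans (·ˢ-assoc H z (z ⁻¹ · z')) (cong (H ·ˢ_) (\\-leftDividesˡ z z'))

    fixesCosets⇒∈core : ∀ {g} → (∀ C → IsRightCoset G H C → Translate G C g C) →
                        ∀ h → h ⁻¹ · g · h ∈ H
    fixesCosets⇒∈core {g} fixes h =
      subst (λ t → h ⁻¹ · g · t ∈ H) (⁻¹-involutive h) (to ∈-·ˢ h⁻¹g∈Hh⁻¹)
      where
      h⁻¹g∈Hh⁻¹ : h ⁻¹ · g ∈ H ·ˢ h ⁻¹
      h⁻¹g∈Hh⁻¹ = from (fixes (H ·ˢ h ⁻¹) (from IsRightCoset⇔ (h ⁻¹ , refl)) (h ⁻¹ · g))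
                       (h ⁻¹ , ∈-·ˢ-self (h ⁻¹) , refl)

module CosetGraph {n} (G : FinGroup n) {L R : Subset n}
                  (L≤G : IsSubgroup G L) (R≤G : IsSubgroup G R) where
  open FinGroup G
  open FinGroupProperties G
  open Cosets G
  module L = Subgroup L≤G
  module R = Subgroup R≤G
  open ≡-Reasoning

  Meets-cosets⇔ : ∀ {x z} → Meets G (L ·ˢ x) (R ·ˢ z) ⇔ InRL G R L (z · x ⁻¹)
  Meets-cosets⇔ {x} {z} = mk⇔ forth back
    where
    forth : Meets G (L ·ˢ x) (R ·ˢ z) → InRL G R L (z · x ⁻¹)
    forth (w , w∈Lx , w∈Rz) =
      (w · z ⁻¹) ⁻¹ , w · x ⁻¹ , R.⁻¹-closed (to ∈-·ˢ w∈Rz) , to ∈-·ˢ w∈Lx , sym (begin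
        (w · z ⁻¹) ⁻¹ · (w · x ⁻¹)     ≡⟨ cong (_· (w · x ⁻¹)) (⁻¹-anti-homo-∙ w (z ⁻¹)) ⟩
        z ⁻¹ ⁻¹ · w ⁻¹ · (w · x ⁻¹)    ≡⟨ cong (λ t → t · w ⁻¹ · (w · x ⁻¹)) (⁻¹-involutive z) ⟩
        z · w ⁻¹ · (w · x ⁻¹)          ≡⟨ assoc z (w ⁻¹) (w · x ⁻¹) ⟩
        z · (w ⁻¹ · (w · x ⁻¹))        ≡⟨ cong (z ·_) (\\-leftDividesʳ w (x ⁻¹)) ⟩
        z · x ⁻¹                       ∎)
    back : InRL G R L (z · x ⁻¹) → Meets G (L ·ˢ x) (R ·ˢ z)
    back (r , l , r∈R , l∈L , zx⁻¹≡rl) =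
      r ⁻¹ · z ,
      from ∈-·ˢ (subst (_∈ L) (sym r⁻¹zx⁻¹≡l) l∈L) ,
      from ∈-·ˢ (subst (_∈ R) (sym (//-rightDividesʳ z (r ⁻¹))) (R.⁻¹-closed r∈R))
      where
      r⁻¹zx⁻¹≡l : r ⁻¹ · z · x ⁻¹ ≡ l
      r⁻¹zx⁻¹≡l = begin
        r ⁻¹ · z · x ⁻¹     ≡⟨ assoc (r ⁻¹) z (x ⁻¹) ⟩
        r ⁻¹ · (z · x ⁻¹)   ≡⟨ cong (r ⁻¹ ·_) zx⁻¹≡rl ⟩
        r ⁻¹ · (r · l)      ≡⟨ \\-leftDividesʳ r l ⟩
        l                   ∎

  InRLg⇔InRL : ∀ {g z} → InRLg G R L g z ⇔ InRL G R L (z · g ⁻¹)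
  InRLg⇔InRL = mk⇔ (λ (r , l , r∈R , l∈L , eq) → r , l , r∈R , l∈L , from ·⁻¹-≡⇔ eq)
                   (λ (r , l , r∈R , l∈L , eq) → r , l , r∈R , l∈L , to ·⁻¹-≡⇔ eq)

  CommonBlocks : Fin n → Fin n → Subset n → Set
  CommonBlocks x y B = IsRightCoset G R B × Meets G (L ·ˢ x) B × Meets G (L ·ˢ y) B

  CommonBlocks? : ∀ x y → Decidable (CommonBlocks x y)
  CommonBlocks? x y B = IsRightCoset? R B ×-dec Meets? (L ·ˢ x) B ×-dec Meets? (L ·ˢ y) B

  RL∩RLg : Fin n → Fin n → Set
  RL∩RLg g w = InRL G R L w × InRLg G R L g w

  CommonBlocks-·ˢ⇔ : ∀ {x y w} → CommonBlocks x y (R ·ˢ (w · x)) ⇔ RL∩RLg (y · x ⁻¹) w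
  CommonBlocks-·ˢ⇔ {x} {y} {w} = mk⇔
    (λ (_ , meets-Lx , meets-Ly) →
      subst (InRL G R L) (//-rightDividesʳ x w) (to Meets-cosets⇔ meets-Lx) ,
      from InRLg⇔InRL (subst (InRL G R L) wxy⁻¹≡w[yx⁻¹]⁻¹ (to Meets-cosets⇔ meets-Ly)))
    (λ (w∈RL , w∈RLg) →
      from IsRightCoset⇔ (w · x , refl) ,
      from Meets-cosets⇔ (subst (InRL G R L) (sym (//-rightDividesʳ x w)) w∈RL) ,
      from Meets-cosets⇔ (subst (InRL G R L) (sym wxy⁻¹≡w[yx⁻¹]⁻¹) (to InRLg⇔InRL w∈RLg)))
    where
    wxy⁻¹≡w[yx⁻¹]⁻¹ : w · x · y ⁻¹ ≡ w · (y · x ⁻¹) ⁻¹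
    wxy⁻¹≡w[yx⁻¹]⁻¹ = begin
      w · x · y ⁻¹             ≡⟨ assoc w x (y ⁻¹) ⟩
      w · (x · y ⁻¹)           ≡⟨ cong (λ t → w · (t · y ⁻¹)) (⁻¹-involutive x) ⟨
      w · (x ⁻¹ ⁻¹ · y ⁻¹)     ≡⟨ cong (w ·_) (⁻¹-anti-homo-∙ y (x ⁻¹)) ⟨
      w · (y · x ⁻¹) ⁻¹        ∎

  HasCard-CommonBlocks⇒RL∩RLg : ∀ {x y} → HasCard (CommonBlocks x y) c →
                                  HasCard (RL∩RLg (y · x ⁻¹)) (c * ∣ R ∣)
  HasCard-CommonBlocks⇒RL∩RLg {x = x} common-card =
    HasCard-cong (λ _ → CommonBlocks-·ˢ⇔)
      (Regular.HasCard-◃ x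
        (Translation.HasCard-orbit R R.HasCard-stabiliser (λ _ → to IsRightCoset⇔ ∘ proj₁)
                                   common-card))

  HasCard-RL∩RLg⇒CommonBlocks : ∀ {x y} → HasCard (RL∩RLg (y · x ⁻¹)) (c * ∣ R ∣) →
                                  HasCard (CommonBlocks x y) c
  HasCard-RL∩RLg⇒CommonBlocks {c} {x} {y} ratio-card
    with c′ , common-card ← ∃HasCard-cosets (CommonBlocks? x y) (λ _ → proj₁) =
    subst (HasCard (CommonBlocks x y))
      (*-cancelʳ-≡ c′ c ∣ R ∣ ⦃ HasCard⇒NonZero R.e∈H (HasCard-∈ R) ⦄
        (HasCard-unique (HasCard-CommonBlocks⇒RL∩RLg common-card) ratio-card))
      common-card

  ii⇒iii : ConstCommonNbrs G L R → ConstRatio G L R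
  ii⇒iii (c , common-card) = c , λ g g∉L →
    subst (λ h → HasCard (RL∩RLg h) (c * ∣ R ∣)) (x·e⁻¹≡x g)
      (HasCard-CommonBlocks⇒RL∩RLg
        (common-card (L ·ˢ e) (L ·ˢ g)
          (from IsRightCoset⇔ (e , refl)) (from IsRightCoset⇔ (g , refl))
          λ Le≡Lg → g∉L (subst (_∈ L) (x·e⁻¹≡x g) (to L.·ˢ-≡⇔ (sym Le≡Lg)))))

  iii⇒ii : ConstRatio G L R → ConstCommonNbrs G L R
  iii⇒ii (c , ratio-card) = c , common-card
    where
    common-card : ∀ P₁ P₂ → IsRightCoset G L P₁ → IsRightCoset G L P₂ → P₁ ≢ P₂ →
                  HasCard (λ B → IsRightCoset G R B × Meets G P₁ B × Meets G P₂ B) c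
    common-card _ _ P₁-coset P₂-coset P₁≢P₂
      with x , refl ← to IsRightCoset⇔ P₁-coset | y , refl ← to IsRightCoset⇔ P₂-coset =
      HasCard-RL∩RLg⇒CommonBlocks
        (ratio-card (y · x ⁻¹) λ yx⁻¹∈L → P₁≢P₂ (sym (from L.·ˢ-≡⇔ yx⁻¹∈L)))

  i⇒ii : CosDesign G L R → ConstCommonNbrs G L R
  i⇒ii (_ , λ′ , _ , common-card , _) = λ′ , common-card

  ii⇒i : CoreFree G (λ x → _∈∩_ G x (L , R)) → ConstCommonNbrs G L R → CosDesign G L R
  ii⇒i core-free (λ′ , common-card)
    with k , R-card ← ∃HasCard-cosets (λ P → IsRightCoset? L P ×-dec Meets? P R) (λ _ → proj₁) =
    k , λ′ , block-card , common-card , faithful , flag-transitive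
    where
    block-card : ∀ B → IsRightCoset G R B → HasCard (λ P → IsRightCoset G L P × Meets G P B) k
    block-card B B-coset with g , refl ← to IsRightCoset⇔ B-coset =
      HasCard-incidentCosets-·ˢ g R-card

    faithful : ∀ g → (∀ P → IsRightCoset G L P → Translate G P g P) →
               (∀ B → IsRightCoset G R B → Translate G B g B) → g ≡ e
    faithful g fixes-points fixes-blocks =
      core-free g λ h → L.fixesCosets⇒∈core fixes-points h , R.fixesCosets⇒∈core fixes-blocks h

    flag-transitive : ∀ P B P′ B′ → IsRightCoset G L P → IsRightCoset G R B → Meets G P B →
                      IsRightCoset G L P′ → IsRightCoset G R B′ → Meets G P′ B′ →
                      ∃[ g ] (Translate G P g P′ × Translate G B g B′)
    flag-transitive _ _ _ _ P-coset B-coset (z , z∈P , z∈B) P′-coset B′-coset (z′ , z′∈P′ , z′∈B′) =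
      z ⁻¹ · z′ ,
      L.Translate-cosets P-coset P′-coset z∈P z′∈P′ ,
      R.Translate-cosets B-coset B′-coset z∈B z′∈B′

module FlagTransitiveDesign {n} {G : FinGroup n} (D : FlagTransitive2Design G) where
  open FinGroup G
  open FinGroupProperties G
  open FlagTransitive2Design D
  module Points = RightAction G actP actP-e actP-·
  module Blocks = RightAction G actB actB-e actB-·

  StabiliserProduct : Pt → Blk → Fin n → Set
  StabiliserProduct α β x = ∃[ b ] ∃[ a ] (actB β b ≡ β × actP α a ≡ α × x ≡ b · a)

  StabiliserProduct· : Pt → Blk → Fin n → Fin n → Set
  StabiliserProduct· α β g x = ∃[ b ] ∃[ a ] (actB β b ≡ β × actP α a ≡ α × x ≡ b · a · g)

  incident⇔StabiliserProduct : ∀ {α β x} → I α β → I α (actB β x) ⇔ StabiliserProduct α β x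
  incident⇔StabiliserProduct {α} {β} {x} αIβ = mk⇔ forth back
    where
    forth : I α (actB β x) → StabiliserProduct α β x
    forth αIβx with h , αh≡α , βh≡βx ← flagTrans α β α (actB β x) αIβ αIβx =
      x · h ⁻¹ , h , to (Blocks.◃-≡⇔ β x h) (sym βh≡βx) , αh≡α , sym (//-rightDividesˡ h x)
    back : StabiliserProduct α β x → I α (actB β x)
    back (b , a , βb≡β , αa≡α , refl) =
      subst₂ I αa≡α (trans (cong (λ B → actB B a) (sym βb≡β)) (actB-· β b a)) (to (actI α β a) αIβ)

  incident⇔StabiliserProduct· : ∀ {α β x} g → I α β →
                                I (actP α g) (actB β x) ⇔ StabiliserProduct· α β g x
  incident⇔StabiliserProduct· {α} {β} {x} g αIβ =
    ⇔.trans (subst₂ (λ p B → I (actP α g) (actB β x) ⇔ I p B)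
                    (Points.◃-inverseʳ α g) (actB-· β x (g ⁻¹)) (actI _ _ (g ⁻¹)))
    (⇔.trans (incident⇔StabiliserProduct αIβ)
      (mk⇔ (λ (b , a , βb≡β , αa≡α , eq) → b , a , βb≡β , αa≡α , to ·⁻¹-≡⇔ eq)
           (λ (b , a , βb≡β , αa≡α , eq) → b , a , βb≡β , αa≡α , from ·⁻¹-≡⇔ eq)))

  ∃HasCard-stabiliser : ∀ β → ∃ (HasCard (λ h → actB β h ≡ β))
  ∃HasCard-stabiliser β =
    dec⇒∃HasCard Data.Fin._≟_ (λ h → HasCard⇒≡-dec finBlk (actB β h) β)
                 (allFin n) (λ h _ → ∈-allFin h)

  HasCard-StabiliserProduct∩ : ∀ α β → I α β → ∀ g → ¬ (actP α g ≡ α) →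
    ∃[ m ] (HasCard (λ h → actB β h ≡ β) m
      × HasCard (λ x → StabiliserProduct α β x × StabiliserProduct· α β g x) (λ' * m))
  HasCard-StabiliserProduct∩ α β αIβ g αg≢α with m , stabiliser-card ← ∃HasCard-stabiliser β =
    m , stabiliser-card ,
    HasCard-cong (λ _ → incident⇔StabiliserProduct αIβ ×-⇔ incident⇔StabiliserProduct· g αIβ)
      (Blocks.HasCard-orbit β stabiliser-card orbit (pairCount α (actP α g) (αg≢α ∘ sym)))
    where
    orbit : ∀ B → I α B × I (actP α g) B → ∃[ h ] actB β h ≡ B
    orbit B (αIB , _) with h , _ , βh≡B ← flagTrans α β α B αIβ αIB = h , βh≡B

lemma2p2 : ∀ {n} (G : FinGroup n) →
  ((L R : Subset n) → IsSubgroup G L → IsSubgroup G R →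
    CoreFree G (λ x → _∈∩_ G x (L , R)) →
    (CosDesign G L R ⇔ ConstCommonNbrs G L R)
      × (ConstCommonNbrs G L R ⇔ ConstRatio G L R))
  × ((D : FlagTransitive2Design G) →
    let open FlagTransitive2Design D
        open FinGroup G
    in ∀ α β → I α β → ∀ g → ¬ (actP α g ≡ α) →
         ∃[ m ] (HasCard (λ h → actB β h ≡ β) m
           × HasCard (λ x → ∃[ b ] ∃[ a ] (actB β b ≡ β × actP α a ≡ α × x ≡ b · a)
                           × ∃[ b ] ∃[ a ] (actB β b ≡ β × actP α a ≡ α × x ≡ (b · a) · g))
                     (λ' * m)))
lemma2p2 G =
  (λ L R L≤G R≤G core-free → let open CosetGraph G L≤G R≤G in
    mk⇔ i⇒ii (ii⇒i core-free) , mk⇔ ii⇒iii iii⇒ii) ,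
  λ D α β αIβ g αg≢α →
    let open FlagTransitiveDesign D
        m , stabiliser-card , product-card = HasCard-StabiliserProduct∩ α β αIβ g αg≢α
    in m , stabiliser-card , HasCard-cong (λ _ → scope-extrusion) product-card
  where
  -- In the statement, the scope of the first ∃[ b ] ∃[ a ] extends over the second conjunct.
  scope-extrusion : ∀ {A B : Set} {P : A → B → Set} {Q : Set} →
                    ((∃[ b ] ∃[ a ] P b a) × Q) ⇔ (∃[ b ] ∃[ a ] (P b a × Q))
  scope-extrusion = mk⇔ (λ ((b , a , p) , q) → b , a , p , q) (λ (b , a , p , q) → (b , a , p) , q)
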